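{- Let $V$ be a variety of Heyting algebras. The following are equivalent: (a) $V$ is B-saturated; (b) for every $A\in V$ and all elements $a_1,\dots,a_n\in A$, if $B$ is the Brouwerian subalgebra of $A^+$ generated by $a_1,\dots,a_n$, then $B^0\in V$.
   Context: A Brouwerian algebra is an algebra $(A,\land,\lor,\to,1)$ in which $(A,\land,\lor)$ is a distributive lattice with top $1$ and $\to$ is relative pseudo-complementation. A Heyting algebra additionally has a constant $0$ which is the least element. For a Heyting algebra $A$, $A^+$ is its $\{\land,\lor,\to,1\}$-reduct. For a Brouwerian algebra $B$: if $B$ has a least element, $B^0$ is $B$ regarded as a Heyting algebra with that element as $0$. Otherwise $B^0$ is the Heyting algebra obtained by adjoining a new least element $0$, with $a\land 0=0\land a=0$, $a\lor 0=0\lor a=a$, $0\to a=1$ and $a\to 0=0$ for $a\in B$. A Heyting algebra $A$ is B-embedded in a Heyting algebra $C$ if $A^+$ embeds into $C^+$ as a Brouwerian algebra. A variety $V$ of Heyting algebras is B-saturated if every Heyting algebra that is B-embedded in some member of $V$ belongs to $V$. -}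

module Defs where

open import Level using (Level; _⊔_; 0ℓ; Setω) renaming (suc to lsuc)
open import Data.Nat using (ℕ)
open import Data.Fin using (Fin)
open import Data.Product using (Σ; _×_; _,_; proj₁; proj₂)
open import Data.Maybe using (Maybe; just; nothing)
open import Relation.Nullary using (¬_)
open import Relation.Binary using (Rel; IsEquivalence)
open import Algebra.Core using (Op₂)
open import Algebra.Definitions using (Congruent₂)
open import Algebra.Lattice.Structures using (IsDistributiveLattice; IsLattice)

-- Brouwerian algebras: (A, ∧, ∨, ⇒, ⊤) with (A, ∧, ∨) a distributive
-- lattice with top ⊤ and ⇒ the relative pseudo-complement, i.e.
--   x ∧ y ≤ z  iff  x ≤ y ⇒ z,   where  x ≤ y  means  x ∧ y ≈ x.

record BrouwerianAlgebra (c ℓ : Level) : Set (lsuc (c ⊔ ℓ)) where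
  infixr 5 _⇒_
  infixr 6 _∨_
  infixr 7 _∧_
  infix 4 _≈_
  field
    Carrier : Set c
    _≈_     : Rel Carrier ℓ
    _∨_     : Op₂ Carrier
    _∧_     : Op₂ Carrier
    _⇒_     : Op₂ Carrier
    ⊤       : Carrier
    isDistributiveLattice : IsDistributiveLattice _≈_ _∨_ _∧_
    ⇒-cong  : Congruent₂ _≈_ _⇒_
    ⊤-max   : ∀ x → (x ∧ ⊤) ≈ x
    residual→ : ∀ x y z → ((x ∧ y) ∧ z) ≈ (x ∧ y) → (x ∧ (y ⇒ z)) ≈ x
    residual← : ∀ x y z → (x ∧ (y ⇒ z)) ≈ x → ((x ∧ y) ∧ z) ≈ (x ∧ y)

  open IsDistributiveLattice isDistributiveLattice public

  infix 4 _≤_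
  _≤_ : Rel Carrier ℓ
  x ≤ y = (x ∧ y) ≈ x

record HeytingAlgebra (c ℓ : Level) : Set (lsuc (c ⊔ ℓ)) where
  field
    brouwerian : BrouwerianAlgebra c ℓ
  open BrouwerianAlgebra brouwerian public
  field
    ⊥       : Carrier
    ⊥-least : ∀ x → ⊥ ≤ x

_⁺ : ∀ {c ℓ} → HeytingAlgebra c ℓ → BrouwerianAlgebra c ℓ
A ⁺ = HeytingAlgebra.brouwerian A

record BrouwerianEmbedding {a ℓa b ℓb : Level}
         (A : BrouwerianAlgebra a ℓa) (B : BrouwerianAlgebra b ℓb)
         : Set (a ⊔ ℓa ⊔ b ⊔ ℓb) where
  private
    module A = BrouwerianAlgebra A
    module B = BrouwerianAlgebra B
  field
    f         : A.Carrier → B.Carrier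
    f-cong    : ∀ {x y} → x A.≈ y → f x B.≈ f y
    injective : ∀ {x y} → f x B.≈ f y → x A.≈ y
    f-∧       : ∀ x y → f (x A.∧ y) B.≈ (f x B.∧ f y)
    f-∨       : ∀ x y → f (x A.∨ y) B.≈ (f x B.∨ f y)
    f-⇒       : ∀ x y → f (x A.⇒ y) B.≈ (f x B.⇒ f y)
    f-⊤       : f A.⊤ B.≈ B.⊤

_B-embeddedIn_ : ∀ {a ℓa c ℓc} → HeytingAlgebra a ℓa → HeytingAlgebra c ℓc
                 → Set (a ⊔ ℓa ⊔ c ⊔ ℓc)
A B-embeddedIn C = BrouwerianEmbedding (A ⁺) (C ⁺)

infixr 5 _t⇒_
infixr 6 _t∨_
infixr 7 _t∧_

data Term : Set where
  var  : ℕ → Term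
  t⊤   : Term
  t⊥   : Term
  _t∧_ : Term → Term → Term
  _t∨_ : Term → Term → Term
  _t⇒_ : Term → Term → Term

⟦_⟧ : ∀ {c ℓ} {A : HeytingAlgebra c ℓ} → Term → (ℕ → HeytingAlgebra.Carrier A)
      → HeytingAlgebra.Carrier A
⟦_⟧ {A = A} (var i)  ρ = ρ i
⟦_⟧ {A = A} t⊤       ρ = HeytingAlgebra.⊤ A
⟦_⟧ {A = A} t⊥       ρ = HeytingAlgebra.⊥ A
⟦_⟧ {A = A} (s t∧ t) ρ = HeytingAlgebra._∧_ A (⟦_⟧ {A = A} s ρ) (⟦_⟧ {A = A} t ρ)
⟦_⟧ {A = A} (s t∨ t) ρ = HeytingAlgebra._∨_ A (⟦_⟧ {A = A} s ρ) (⟦_⟧ {A = A} t ρ)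
⟦_⟧ {A = A} (s t⇒ t) ρ = HeytingAlgebra._⇒_ A (⟦_⟧ {A = A} s ρ) (⟦_⟧ {A = A} t ρ)

-- A variety is given by an (arbitrary) set of equations s ≈ t.
Variety : Set₁
Variety = Term → Term → Set

_∈V_ : ∀ {c ℓ} → HeytingAlgebra c ℓ → Variety → Set (c ⊔ ℓ)
A ∈V V = ∀ s t → V s t → ∀ (ρ : ℕ → HeytingAlgebra.Carrier A) →
         HeytingAlgebra._≈_ A (⟦_⟧ {A = A} s ρ) (⟦_⟧ {A = A} t ρ)

data BTerm (n : ℕ) : Set where
  gen  : Fin n → BTerm n
  b⊤   : BTerm n
  _b∧_ : BTerm n → BTerm n → BTerm n
  _b∨_ : BTerm n → BTerm n → BTerm n
  _b⇒_ : BTerm n → BTerm n → BTerm n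

module _ {c ℓ} (B : BrouwerianAlgebra c ℓ) where
  open BrouwerianAlgebra B

  evalB : ∀ {n} → (Fin n → Carrier) → BTerm n → Carrier
  evalB a (gen i)  = a i
  evalB a b⊤       = ⊤
  evalB a (s b∧ t) = evalB a s ∧ evalB a t
  evalB a (s b∨ t) = evalB a s ∨ evalB a t
  evalB a (s b⇒ t) = evalB a s ⇒ evalB a t

  generated : ∀ {n} → (Fin n → Carrier) → BrouwerianAlgebra (c ⊔ ℓ) ℓ
  generated {n} a = record
    { Carrier = S
    ; _≈_ = λ x y → proj₁ x ≈ proj₁ y
    ; _∨_ = λ { (x , s , p) (y , t , q) → (x ∨ y , s b∨ t , ∨-cong p q) }
    ; _∧_ = λ { (x , s , p) (y , t , q) → (x ∧ y , s b∧ t , ∧-cong p q) }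
    ; _⇒_ = λ { (x , s , p) (y , t , q) → (x ⇒ y , s b⇒ t , ⇒-cong p q) }
    ; ⊤ = (⊤ , b⊤ , refl)
    ; isDistributiveLattice = record
      { isLattice = record
        { isEquivalence = record { refl = refl ; sym = sym ; trans = trans }
        ; ∨-comm = λ x y → ∨-comm (proj₁ x) (proj₁ y)
        ; ∨-assoc = λ x y z → ∨-assoc (proj₁ x) (proj₁ y) (proj₁ z)
        ; ∨-cong = ∨-cong
        ; ∧-comm = λ x y → ∧-comm (proj₁ x) (proj₁ y)
        ; ∧-assoc = λ x y z → ∧-assoc (proj₁ x) (proj₁ y) (proj₁ z)
        ; ∧-cong = ∧-cong
        ; absorptive = (λ x y → ∨-absorbs-∧ (proj₁ x) (proj₁ y))
                     , (λ x y → ∧-absorbs-∨ (proj₁ x) (proj₁ y))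
        }
      ; ∨-distrib-∧ = (λ x y z → ∨-distribˡ-∧ (proj₁ x) (proj₁ y) (proj₁ z))
                    , (λ x y z → ∨-distribʳ-∧ (proj₁ x) (proj₁ y) (proj₁ z))
      ; ∧-distrib-∨ = (λ x y z → ∧-distribˡ-∨ (proj₁ x) (proj₁ y) (proj₁ z))
                    , (λ x y z → ∧-distribʳ-∨ (proj₁ x) (proj₁ y) (proj₁ z))
      }
    ; ⇒-cong = ⇒-cong
    ; ⊤-max = λ x → ⊤-max (proj₁ x)
    ; residual→ = λ x y z → residual→ (proj₁ x) (proj₁ y) (proj₁ z)
    ; residual← = λ x y z → residual← (proj₁ x) (proj₁ y) (proj₁ z)
    }
    where
    S : Set (c ⊔ ℓ)
    S = Σ Carrier (λ x → Σ (BTerm n) (λ t → evalB a t ≈ x))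

GeneratedSubalgebra : ∀ {c ℓ} (A : HeytingAlgebra c ℓ) (n : ℕ)
                      → (Fin n → HeytingAlgebra.Carrier A)
                      → BrouwerianAlgebra (c ⊔ ℓ) ℓ
GeneratedSubalgebra A n a = generated (A ⁺) a

IsLeast : ∀ {c ℓ} (B : BrouwerianAlgebra c ℓ) → BrouwerianAlgebra.Carrier B → Set (c ⊔ ℓ)
IsLeast B b = ∀ x → BrouwerianAlgebra._≤_ B b x

HasLeast : ∀ {c ℓ} (B : BrouwerianAlgebra c ℓ) → Set (c ⊔ ℓ)
HasLeast B = Σ (BrouwerianAlgebra.Carrier B) (IsLeast B)

-- Case 1: B has a least element b; B⁰ is B with b as 0.
withBottom : ∀ {c ℓ} (B : BrouwerianAlgebra c ℓ) (b : BrouwerianAlgebra.Carrier B)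
             → IsLeast B b → HeytingAlgebra c ℓ
withBottom B b least = record { brouwerian = B ; ⊥ = b ; ⊥-least = least }

-- Case 2: adjoin a new least element 0 (represented by nothing).
module Adjoin {c ℓ} (B : BrouwerianAlgebra c ℓ) where
  open BrouwerianAlgebra B

  M : Set c
  M = Maybe Carrier

  data _≈M_ : Rel M (c ⊔ ℓ) where
    just    : ∀ {x y} → x ≈ y → just x ≈M just y
    nothing : nothing ≈M nothing

  _∧M_ : Op₂ M
  nothing ∧M y      = nothing
  just x  ∧M nothing = nothing
  just x  ∧M just y  = just (x ∧ y)

  _∨M_ : Op₂ M
  nothing ∨M y       = y
  just x  ∨M nothing = just x
  just x  ∨M just y  = just (x ∨ y)

  _⇒M_ : Op₂ M
  nothing ⇒M y       = just ⊤
  just x  ⇒M nothing = nothing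
  just x  ⇒M just y  = just (x ⇒ y)

  reflM : ∀ {x} → x ≈M x
  reflM {just x}  = just refl
  reflM {nothing} = nothing

  symM : ∀ {x y} → x ≈M y → y ≈M x
  symM (just p) = just (sym p)
  symM nothing  = nothing

  transM : ∀ {x y z} → x ≈M y → y ≈M z → x ≈M z
  transM (just p) (just q) = just (trans p q)
  transM nothing  nothing  = nothing

  idem : ∀ a → (a ∧ a) ≈ a
  idem a = trans (∧-cong refl (sym (∨-absorbs-∧ a a))) (∧-absorbs-∨ a (a ∧ a))

  ∨M-comm : ∀ x y → (x ∨M y) ≈M (y ∨M x)
  ∨M-comm nothing  nothing  = nothing
  ∨M-comm nothing  (just y) = reflM
  ∨M-comm (just x) nothing  = reflM
  ∨M-comm (just x) (just y) = just (∨-comm x y)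

  ∨M-assoc : ∀ x y z → ((x ∨M y) ∨M z) ≈M (x ∨M (y ∨M z))
  ∨M-assoc nothing  y        z        = reflM
  ∨M-assoc (just x) nothing  z        = reflM
  ∨M-assoc (just x) (just y) nothing  = reflM
  ∨M-assoc (just x) (just y) (just z) = just (∨-assoc x y z)

  ∨M-cong : Congruent₂ _≈M_ _∨M_
  ∨M-cong nothing  q        = q
  ∨M-cong (just p) nothing  = just p
  ∨M-cong (just p) (just q) = just (∨-cong p q)

  ∧M-comm : ∀ x y → (x ∧M y) ≈M (y ∧M x)
  ∧M-comm nothing  nothing  = nothing
  ∧M-comm nothing  (just y) = nothing
  ∧M-comm (just x) nothing  = nothing
  ∧M-comm (just x) (just y) = just (∧-comm x y)

  ∧M-assoc : ∀ x y z → ((x ∧M y) ∧M z) ≈M (x ∧M (y ∧M z))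
  ∧M-assoc nothing  y        z        = nothing
  ∧M-assoc (just x) nothing  z        = nothing
  ∧M-assoc (just x) (just y) nothing  = nothing
  ∧M-assoc (just x) (just y) (just z) = just (∧-assoc x y z)

  ∧M-cong : Congruent₂ _≈M_ _∧M_
  ∧M-cong nothing  q        = nothing
  ∧M-cong (just p) nothing  = nothing
  ∧M-cong (just p) (just q) = just (∧-cong p q)

  ∨M-absorbs-∧M : ∀ x y → (x ∨M (x ∧M y)) ≈M x
  ∨M-absorbs-∧M nothing  y        = nothing
  ∨M-absorbs-∧M (just x) nothing  = reflM
  ∨M-absorbs-∧M (just x) (just y) = just (∨-absorbs-∧ x y)

  ∧M-absorbs-∨M : ∀ x y → (x ∧M (x ∨M y)) ≈M x
  ∧M-absorbs-∨M nothing  y        = nothing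
  ∧M-absorbs-∨M (just x) nothing  = just (idem x)
  ∧M-absorbs-∨M (just x) (just y) = just (∧-absorbs-∨ x y)

  ∨M-distribˡ : ∀ x y z → (x ∨M (y ∧M z)) ≈M ((x ∨M y) ∧M (x ∨M z))
  ∨M-distribˡ nothing  y        z        = reflM
  ∨M-distribˡ (just x) nothing  nothing  = just (sym (idem x))
  ∨M-distribˡ (just x) nothing  (just z) = just (sym (∧-absorbs-∨ x z))
  ∨M-distribˡ (just x) (just y) nothing  =
    just (sym (trans (∧-comm (x ∨ y) x) (∧-absorbs-∨ x y)))
  ∨M-distribˡ (just x) (just y) (just z) = just (∨-distribˡ-∧ x y z)

  ∨M-distribʳ : ∀ x y z → ((y ∧M z) ∨M x) ≈M ((y ∨M x) ∧M (z ∨M x))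
  ∨M-distribʳ x y z =
    transM (∨M-comm (y ∧M z) x)
      (transM (∨M-distribˡ x y z) (∧M-cong (∨M-comm x y) (∨M-comm x z)))

  ∧M-distribˡ : ∀ x y z → (x ∧M (y ∨M z)) ≈M ((x ∧M y) ∨M (x ∧M z))
  ∧M-distribˡ nothing  y        z        = nothing
  ∧M-distribˡ (just x) nothing  z        = reflM
  ∧M-distribˡ (just x) (just y) nothing  = reflM
  ∧M-distribˡ (just x) (just y) (just z) = just (∧-distribˡ-∨ x y z)

  ∧M-distribʳ : ∀ x y z → ((y ∨M z) ∧M x) ≈M ((y ∧M x) ∨M (z ∧M x))
  ∧M-distribʳ x y z =
    transM (∧M-comm (y ∨M z) x)
      (transM (∧M-distribˡ x y z) (∨M-cong (∧M-comm x y) (∧M-comm x z)))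

  ⇒M-cong : Congruent₂ _≈M_ _⇒M_
  ⇒M-cong nothing  q        = reflM
  ⇒M-cong (just p) nothing  = nothing
  ⇒M-cong (just p) (just q) = just (⇒-cong p q)

  ⊤M-max : ∀ x → (x ∧M just ⊤) ≈M x
  ⊤M-max nothing  = nothing
  ⊤M-max (just x) = just (⊤-max x)

  residualM→ : ∀ x y z → ((x ∧M y) ∧M z) ≈M (x ∧M y) → (x ∧M (y ⇒M z)) ≈M x
  residualM→ nothing  y        z        h        = nothing
  residualM→ (just x) nothing  z        h        = just (⊤-max x)
  residualM→ (just x) (just y) nothing  ()
  residualM→ (just x) (just y) (just z) (just h) = just (residual→ x y z h)

  residualM← : ∀ x y z → (x ∧M (y ⇒M z)) ≈M x → ((x ∧M y) ∧M z) ≈M (x ∧M y)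
  residualM← nothing  y        z        h        = nothing
  residualM← (just x) nothing  z        h        = nothing
  residualM← (just x) (just y) nothing  ()
  residualM← (just x) (just y) (just z) (just h) = just (residual← x y z h)

  brouwerianM : BrouwerianAlgebra c (c ⊔ ℓ)
  brouwerianM = record
    { Carrier = M
    ; _≈_ = _≈M_
    ; _∨_ = _∨M_
    ; _∧_ = _∧M_
    ; _⇒_ = _⇒M_
    ; ⊤ = just ⊤
    ; isDistributiveLattice = record
      { isLattice = record
        { isEquivalence = record { refl = reflM ; sym = symM ; trans = transM }
        ; ∨-comm = ∨M-comm
        ; ∨-assoc = ∨M-assoc
        ; ∨-cong = ∨M-cong
        ; ∧-comm = ∧M-comm
        ; ∧-assoc = ∧M-assoc
        ; ∧-cong = ∧M-cong
        ; absorptive = ∨M-absorbs-∧M , ∧M-absorbs-∨M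
        }
      ; ∨-distrib-∧ = ∨M-distribˡ , ∨M-distribʳ
      ; ∧-distrib-∨ = ∧M-distribˡ , ∧M-distribʳ
      }
    ; ⇒-cong = ⇒M-cong
    ; ⊤-max = ⊤M-max
    ; residual→ = residualM→
    ; residual← = residualM←
    }

  adjoined : HeytingAlgebra c (c ⊔ ℓ)
  adjoined = record
    { brouwerian = brouwerianM
    ; ⊥ = nothing
    ; ⊥-least = λ x → nothing
    }

adjoinBottom : ∀ {c ℓ} → BrouwerianAlgebra c ℓ → HeytingAlgebra c (c ⊔ ℓ)
adjoinBottom B = Adjoin.adjoined B

-- "B⁰ ∈ V", split according to the two cases of the definition of B⁰.
B⁰∈V : ∀ {c ℓ} → BrouwerianAlgebra c ℓ → Variety → Set (c ⊔ ℓ)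
B⁰∈V B V =
    (∀ (b : BrouwerianAlgebra.Carrier B) (least : IsLeast B b) → withBottom B b least ∈V V)
  × (¬ HasLeast B → adjoinBottom B ∈V V)

BSaturated : Variety → Setω
BSaturated V =
  ∀ {a ℓa c ℓc} (A : HeytingAlgebra a ℓa) (C : HeytingAlgebra c ℓc)
  → C ∈V V → A B-embeddedIn C → A ∈V V

FinGenCondition : Variety → Setω
FinGenCondition V =
  ∀ {c ℓ} (A : HeytingAlgebra c ℓ) → A ∈V V
  → ∀ (n : ℕ) (a : Fin n → HeytingAlgebra.Carrier A)
  → B⁰∈V (GeneratedSubalgebra A n a) V

record _⇔ω_ (P Q : Setω) : Setω where
  field
    to   : P → Q
    from : Q → P

module Submission where

-- (a) ⇒ (b).  A finitely generated Brouwerian algebra always has a least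
-- element, namely the meet of its generators (⊤ if there are none), so
-- B⁰ is B itself with that bottom; B⁰⁺ = B embeds into A⁺ by inclusion,
-- and B-saturation gives B⁰ ∈ V.  The "adjoin a new bottom" case of B⁰
-- never arises.
--
-- (b) ⇒ (a).  Let f : A⁺ → C⁺ be an embedding with C ∈ V, and let s ≈ t be
-- an equation of V and ρ a valuation in A.  Only the variables below some
-- bound N occur in s and t.  Let B be the Brouwerian subalgebra of C⁺
-- generated by f ⊥ and f (ρ j), j < N.  Its generator f ⊥ lies below all
-- generators, hence is the least element of B, so H = (B with bottom f ⊥)
-- is in V by (b).  Evaluating s, t in H at σ j = f (ρ j) agrees with
-- applying f to their values in A at ρ, since both the inclusion H⁺ → C⁺
-- and f preserve ∧, ∨, ⇒, ⊤ and they send the two bottoms to the same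
-- element.  So f (⟦s⟧ρ) ≈ f (⟦t⟧ρ), and injectivity of f concludes.

open import Defs
open import Level using () renaming (_⊔_ to _⊔ˡ_)
open import Data.Nat as ℕ using (ℕ; zero; suc; _<_; _<?_; _⊔_)
open import Data.Nat.Properties using (m≤m⊔n; m≤n⊔m; <-≤-trans; n<1+n)
open import Data.Fin using (Fin; zero; suc; toℕ; fromℕ<)
open import Data.Fin.Properties using (toℕ-fromℕ<)
open import Data.Product using (_,_; proj₁)
open import Data.Empty using (⊥-elim)
open import Function using (_∘_)
open import Relation.Nullary using (¬_; yes; no)
open import Relation.Binary.PropositionalEquality using (cong)
open import Algebra.Lattice.Bundles using (Lattice)
import Algebra.Lattice.Properties.Lattice as LatticeProperties
import Relation.Binary.Lattice as OrderLattice

-- The lattice order x ≤ y (x ∧ y ≈ x) of a Brouwerian algebra.  The library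
-- provides the order theory for x ≈ x ∧ y, which differs from ours only by
-- symmetry of ≈.
module BrouwerianOrder {c ℓ} (X : BrouwerianAlgebra c ℓ) where
  open BrouwerianAlgebra X

  private
    lattice : Lattice c ℓ
    lattice = record { isLattice = isLattice }
    module L = LatticeProperties lattice
    module O = OrderLattice.Lattice L.∨-∧-orderTheoreticLattice

  ≤-refl : ∀ x → x ≤ x
  ≤-refl = L.∧-idem

  ≤-trans : ∀ {x y z} → x ≤ y → y ≤ z → x ≤ z
  ≤-trans p q = sym (O.trans (sym p) (sym q))

  ≤-respʳ : ∀ {x y z} → x ≤ y → y ≈ z → x ≤ z
  ≤-respʳ p y≈z = trans (∧-cong refl (sym y≈z)) p

  x∧y≤x : ∀ x y → (x ∧ y) ≤ x
  x∧y≤x x y = sym (O.x∧y≤x x y)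

  x∧y≤y : ∀ x y → (x ∧ y) ≤ y
  x∧y≤y x y = sym (O.x∧y≤y x y)

  ∧-greatest : ∀ {x y z} → x ≤ y → x ≤ z → x ≤ (y ∧ z)
  ∧-greatest p q = sym (O.∧-greatest (sym p) (sym q))

  x≤x∨y : ∀ x y → x ≤ (x ∨ y)
  x≤x∨y x y = sym (O.x≤x∨y x y)

  -- Anything below y is below x ⇒ y (since z ∧ x ≤ y, by residuation).
  ≤-⇒ : ∀ {x y z} → z ≤ y → z ≤ (x ⇒ y)
  ≤-⇒ {x} {y} {z} z≤y = residual→ z x y (≤-trans (x∧y≤x z x) z≤y)

record BrouwerianHomomorphism {a ℓa b ℓb}
         (A : BrouwerianAlgebra a ℓa) (B : BrouwerianAlgebra b ℓb)
         : Set (a ⊔ˡ ℓa ⊔ˡ b ⊔ˡ ℓb) where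
  private
    module A = BrouwerianAlgebra A
    module B = BrouwerianAlgebra B
  field
    map    : A.Carrier → B.Carrier
    map-≈  : ∀ {x y} → x A.≈ y → map x B.≈ map y
    ∧-homo : ∀ x y → map (x A.∧ y) B.≈ (map x B.∧ map y)
    ∨-homo : ∀ x y → map (x A.∨ y) B.≈ (map x B.∨ map y)
    ⇒-homo : ∀ x y → map (x A.⇒ y) B.≈ (map x B.⇒ map y)
    ⊤-homo : map A.⊤ B.≈ B.⊤

embedding⇒homomorphism : ∀ {a ℓa b ℓb}
  {A : BrouwerianAlgebra a ℓa} {B : BrouwerianAlgebra b ℓb}
  → BrouwerianEmbedding A B → BrouwerianHomomorphism A B
embedding⇒homomorphism e = record
  { map = f ; map-≈ = f-cong ; ∧-homo = f-∧ ; ∨-homo = f-∨ ; ⇒-homo = f-⇒ ; ⊤-homo = f-⊤ }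
  where open BrouwerianEmbedding e

module Generated {c ℓ} (X : BrouwerianAlgebra c ℓ) where
  open BrouwerianAlgebra X
  open BrouwerianOrder X

  -- A lower bound of the generators bounds every generated element: the
  -- operations ∧, ∨, ⇒ and the constant ⊤ all preserve "being above z".
  generators-bound : ∀ {n} (a : Fin n → Carrier) {z}
    → (∀ i → z ≤ a i) → ∀ t → z ≤ evalB X a t
  generators-bound a z≤a (gen i)  = z≤a i
  generators-bound a z≤a b⊤       = ⊤-max _
  generators-bound a z≤a (s b∧ t) =
    ∧-greatest (generators-bound a z≤a s) (generators-bound a z≤a t)
  generators-bound a z≤a (s b∨ t) =
    ≤-trans (generators-bound a z≤a s) (x≤x∨y _ _)
  generators-bound a z≤a (s b⇒ t) = ≤-⇒ (generators-bound a z≤a t)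

  element : ∀ {n} (a : Fin n → Carrier) → BTerm n
          → BrouwerianAlgebra.Carrier (generated X a)
  element a t = evalB X a t , t , refl

  lowerBound-least : ∀ {n} (a : Fin n → Carrier) (t₀ : BTerm n)
    → (∀ i → evalB X a t₀ ≤ a i) → IsLeast (generated X a) (element a t₀)
  lowerBound-least a t₀ t₀≤a (y , t , t≈y) =
    ≤-respʳ (generators-bound a t₀≤a t) t≈y

  ⋀ : ∀ {m n} → (Fin m → BTerm n) → BTerm n
  ⋀ {zero}  ts = b⊤
  ⋀ {suc m} ts = ts zero b∧ ⋀ (ts ∘ suc)

  ⋀-lower : ∀ {m n} (a : Fin n → Carrier) (ts : Fin m → BTerm n) (i : Fin m)
    → evalB X a (⋀ ts) ≤ evalB X a (ts i)
  ⋀-lower a ts zero    = x∧y≤x _ _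
  ⋀-lower a ts (suc i) = ≤-trans (x∧y≤y _ _) (⋀-lower a (ts ∘ suc) i)

  generated-hasLeast : ∀ {n} (a : Fin n → Carrier) → HasLeast (generated X a)
  generated-hasLeast a = element a (⋀ gen) , lowerBound-least a (⋀ gen) (⋀-lower a gen)

  inclusion : ∀ {n} (a : Fin n → Carrier) → BrouwerianEmbedding (generated X a) X
  inclusion a = record
    { f = proj₁ ; f-cong = λ p → p ; injective = λ p → p
    ; f-∧ = λ _ _ → refl ; f-∨ = λ _ _ → refl ; f-⇒ = λ _ _ → refl
    ; f-⊤ = refl }

saturated⇒finGen : (V : Variety) → BSaturated V → FinGenCondition V
saturated⇒finGen V saturated A A∈V n a = withBottom∈V , adjoined∈V
  where
  open Generated (A ⁺)
  B : BrouwerianAlgebra _ _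
  B = GeneratedSubalgebra A n a

  withBottom∈V : ∀ b least → withBottom B b least ∈V V
  withBottom∈V b least = saturated (withBottom B b least) A A∈V (inclusion a)

  adjoined∈V : (noLeast : ¬ HasLeast B) → adjoinBottom B ∈V V
  adjoined∈V noLeast = ⊥-elim (noLeast (generated-hasLeast a))

varBound : Term → ℕ
varBound (var i)  = suc i
varBound t⊤       = zero
varBound t⊥       = zero
varBound (s t∧ t) = varBound s ⊔ varBound t
varBound (s t∨ t) = varBound s ⊔ varBound t
varBound (s t⇒ t) = varBound s ⊔ varBound t

module Span {h ℓh a ℓa c ℓc}
  (H : HeytingAlgebra h ℓh) (A : HeytingAlgebra a ℓa) (C : BrouwerianAlgebra c ℓc)
  (g : BrouwerianHomomorphism (H ⁺) C) (k : BrouwerianHomomorphism (A ⁺) C)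
  where
  private
    module H = HeytingAlgebra H
    module A = HeytingAlgebra A
    module g = BrouwerianHomomorphism g
    module k = BrouwerianHomomorphism k
  open BrouwerianAlgebra C

  module _ (bottoms : g.map H.⊥ ≈ k.map A.⊥)
           (σ : ℕ → H.Carrier) (ρ : ℕ → A.Carrier) where

    Agree : ℕ → Set ℓc
    Agree n = ∀ j → j < n → g.map (σ j) ≈ k.map (ρ j)

    agree-mono : ∀ {m n} → m ℕ.≤ n → Agree n → Agree m
    agree-mono m≤n agree j j<m = agree j (<-≤-trans j<m m≤n)

    agreeˡ : ∀ u v → Agree (varBound u ⊔ varBound v) → Agree (varBound u)
    agreeˡ u v = agree-mono (m≤m⊔n (varBound u) (varBound v))

    agreeʳ : ∀ u v → Agree (varBound u ⊔ varBound v) → Agree (varBound v)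
    agreeʳ u v = agree-mono (m≤n⊔m (varBound u) (varBound v))

    eval-span : ∀ u → Agree (varBound u)
      → g.map (⟦_⟧ {A = H} u σ) ≈ k.map (⟦_⟧ {A = A} u ρ)
    eval-span (var j)  agree = agree j (n<1+n j)
    eval-span t⊤       agree = trans g.⊤-homo (sym k.⊤-homo)
    eval-span t⊥       agree = bottoms
    eval-span (u t∧ v) agree = trans (g.∧-homo _ _)
      (trans (∧-cong (eval-span u (agreeˡ u v agree)) (eval-span v (agreeʳ u v agree)))
             (sym (k.∧-homo _ _)))
    eval-span (u t∨ v) agree = trans (g.∨-homo _ _)
      (trans (∨-cong (eval-span u (agreeˡ u v agree)) (eval-span v (agreeʳ u v agree)))
             (sym (k.∨-homo _ _)))
    eval-span (u t⇒ v) agree = trans (g.⇒-homo _ _)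
      (trans (⇒-cong (eval-span u (agreeˡ u v agree)) (eval-span v (agreeʳ u v agree)))
             (sym (k.⇒-homo _ _)))

module Witness {a ℓa c ℓc} (A : HeytingAlgebra a ℓa) (C : HeytingAlgebra c ℓc)
  (e : A B-embeddedIn C) (N : ℕ) (ρ : ℕ → HeytingAlgebra.Carrier A) where
  private
    module A = HeytingAlgebra A
    module C = HeytingAlgebra C
  open BrouwerianEmbedding e
  open Generated (C ⁺)

  generators : Fin (suc N) → C.Carrier
  generators zero    = f A.⊥
  generators (suc i) = f (ρ (toℕ i))

  B : BrouwerianAlgebra _ _
  B = GeneratedSubalgebra C (suc N) generators

  bottom-least : IsLeast B (element generators (gen zero))
  bottom-least = lowerBound-least generators (gen zero) below
    where
    below : ∀ j → f A.⊥ C.≤ generators j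
    below zero    = BrouwerianOrder.≤-refl (C ⁺) (f A.⊥)
    below (suc i) = C.trans (C.sym (f-∧ _ _)) (f-cong (A.⊥-least _))

  H : HeytingAlgebra _ _
  H = withBottom B (element generators (gen zero)) bottom-least

  -- The valuation in H sending j < N to f (ρ j) (and the rest to bottom).
  σ : ℕ → HeytingAlgebra.Carrier H
  σ j with j <? N
  ... | yes j<N = f (ρ j) , gen (suc (fromℕ< j<N))
                , f-cong (A.reflexive (cong ρ (toℕ-fromℕ< j<N)))
  ... | no _    = element generators (gen zero)

  σ-agree : ∀ j → j < N → proj₁ (σ j) C.≈ f (ρ j)
  σ-agree j j<N with j <? N
  ... | yes _   = C.refl
  ... | no j≮N = ⊥-elim (j≮N j<N)

  eval-H : ∀ u → varBound u ℕ.≤ N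
    → proj₁ (⟦_⟧ {A = H} u σ) C.≈ f (⟦_⟧ {A = A} u ρ)
  eval-H u u≤N =
    Span.eval-span H A (C ⁺) (embedding⇒homomorphism (inclusion generators))
      (embedding⇒homomorphism e) C.refl σ ρ u
      (λ j j<u → σ-agree j (<-≤-trans j<u u≤N))

finGen⇒saturated : (V : Variety) → FinGenCondition V → BSaturated V
finGen⇒saturated V finGen A C C∈V e s t s≈t ρ =
  injective (C.trans (C.sym (eval-H s (m≤m⊔n _ _)))
              (C.trans (H∈V s t s≈t σ) (eval-H t (m≤n⊔m (varBound s) _))))
  where
  module C = HeytingAlgebra C
  open BrouwerianEmbedding e using (injective)
  open Witness A C e (varBound s ⊔ varBound t) ρ

  H∈V : H ∈V V
  H∈V = proj₁ (finGen C C∈V _ generators) _ bottom-least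

mainTheorem10 : (V : Variety) → BSaturated V ⇔ω FinGenCondition V
mainTheorem10 V = record { to = saturated⇒finGen V ; from = finGen⇒saturated V }
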